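{- Let $p$ be a positive integer and let $G$ be a $\mathbf{W}_{p}$ graph. Then every connected component of $G$ contains at least $p$ vertices; consequently $n(G)\geq p\cdot c(G)$, where $n(G)$ is the number of vertices of $G$ and $c(G)$ is the number of connected components of $G$.
   Context: All graphs are finite, simple, undirected and loopless. An independent set is a set of pairwise non-adjacent vertices; $\alpha(G)$ is the maximum size of an independent set, and a maximum independent set is one of size $\alpha(G)$. For a positive integer $p$, a graph $G$ is a $\mathbf{W}_{p}$ graph if $n(G)\geq p$ and for every $p$ pairwise disjoint independent sets $A_1,\ldots,A_p$ of $G$ there exist $p$ pairwise disjoint maximum independent sets $S_1,\ldots,S_p$ of $G$ with $A_i\subseteq S_i$ for $1\le i\le p$. -}

module Defs where

open import Data.Nat using (ℕ; _≤_; _*_)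
open import Data.Bool using (Bool; true; false)
open import Data.Fin using (Fin)
open import Data.Fin.Subset using (Subset; _∈_; _⊆_; ∣_∣)
open import Data.Product using (Σ; _×_; ∃)
open import Relation.Binary.PropositionalEquality using (_≡_; _≢_)
open import Relation.Binary.Construct.Closure.ReflexiveTransitive using (Star)
open import Relation.Nullary using (¬_)
open import Function.Bundles using (_⇔_)

record Graph (n : ℕ) : Set where
  field
    adj   : Fin n → Fin n → Bool
    sym   : ∀ i j → adj i j ≡ adj j i
    loopless : ∀ i → adj i i ≡ false

open Graph public

nV : ∀ {n} → Graph n → ℕ
nV {n} _ = n

Adj : ∀ {n} → Graph n → Fin n → Fin n → Set
Adj G i j = adj G i j ≡ true

Connected : ∀ {n} → Graph n → Fin n → Fin n → Set
Connected G = Star (Adj G)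

Independent : ∀ {n} → Graph n → Subset n → Set
Independent G A = ∀ i j → i ∈ A → j ∈ A → adj G i j ≡ false

MaxIndependent : ∀ {n} → Graph n → Subset n → Set
MaxIndependent {n} G S =
  Independent G S × (∀ (T : Subset n) → Independent G T → ∣ T ∣ ≤ ∣ S ∣)

Disjoint : ∀ {n} → Subset n → Subset n → Set
Disjoint A B = ∀ x → x ∈ A → ¬ (x ∈ B)

PairwiseDisjoint : ∀ {n p} → (Fin p → Subset n) → Set
PairwiseDisjoint {p = p} A = ∀ (i j : Fin p) → i ≢ j → Disjoint (A i) (A j)

W : ∀ {n} → ℕ → Graph n → Set
W {n} p G =
  p ≤ n ×
  (∀ (A : Fin p → Subset n) → PairwiseDisjoint A → (∀ i → Independent G (A i)) →
     Σ (Fin p → Subset n) λ S →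
       PairwiseDisjoint S × (∀ i → MaxIndependent G (S i)) × (∀ i → A i ⊆ S i))

IsComponentOf : ∀ {n} → Graph n → Fin n → Subset n → Set
IsComponentOf {n} G v C = ∀ (u : Fin n) → (u ∈ C) ⇔ Connected G v u

-- G has exactly k connected components: a surjective labelling of the vertices
-- by Fin k whose fibres are exactly the connected components.
HasComponentCount : ∀ {n} → Graph n → ℕ → Set
HasComponentCount {n} G k =
  Σ (Fin n → Fin k) λ f →
    (∀ (c : Fin k) → ∃ λ (v : Fin n) → f v ≡ c) ×
    (∀ (u v : Fin n) → (f u ≡ f v) ⇔ Connected G u v)

-- A W_p graph has p pairwise disjoint maximum independent sets S₁, …, Sₚ (extend p empty
-- sets). A maximum independent set is dominating, so every vertex v has some vertex of
-- each Sᵢ at distance at most 1, hence in its component. Since the Sᵢ are disjoint these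
-- p vertices are distinct, so every component has at least p vertices; choosing them
-- for a representative of each of the k components gives p · k distinct vertices.
module Submission where

open import Defs hiding (sym)
open import Data.Nat using (ℕ; _≤_; _<_; _*_; NonZero; zero; suc; z≤n)
open import Data.Nat.Properties using (≤-<-trans; <⇒≱)
open import Data.Bool using (true; false)
open import Data.Bool.Properties using (¬-not) renaming (_≟_ to _≟ᵇ_)
open import Data.Fin using (Fin; zero; suc; _≟_; remQuot)
open import Data.Fin.Properties using (any?; injective⇒≤; suc-injective; 0≢1+n; *↔×)
open import Data.Fin.Subset using (Subset; ∣_∣; _∈_; _∉_; _∪_; ⁅_⁆; _-_; ⊥)
open import Data.Fin.Subset.Properties
  using (_∈?_; ∉⊥; p⊂q⇒∣p∣<∣q∣; p⊆p∪q; x∈p∪q⁺; x∈p∪q⁻; x∈⁅x⁆; x∈⁅y⁆⇒x≡y; x∈p∧x≢y⇒x∈p-y; x∈p⇒∣p-x∣<∣p∣)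
open import Data.Product using (_×_; _,_; proj₁; proj₂; Σ; ∃)
open import Data.Sum using (inj₁; inj₂)
open import Relation.Nullary using (yes; no; contradiction)
open import Relation.Nullary.Decidable using (_×-dec_)
open import Relation.Binary.PropositionalEquality using (_≡_; refl; sym; trans; cong; subst)
open import Relation.Binary.Construct.Closure.ReflexiveTransitive using (ε; _◅_)
open import Function using (_∘_; Injective)
open import Function.Bundles using (Injection; Equivalence)
open import Function.Properties.Inverse using (↔⇒↣)

injective-into⇒≤∣p∣ : ∀ {m n} {f : Fin m → Fin n} (p : Subset n) →
  Injective _≡_ _≡_ f → (∀ i → f i ∈ p) → m ≤ ∣ p ∣
injective-into⇒≤∣p∣ {zero} _ _ _ = z≤n
injective-into⇒≤∣p∣ {suc m} {f = f} p f-injective f∈p =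
  ≤-<-trans (injective-into⇒≤∣p∣ (p - f zero) (suc-injective ∘ f-injective) f∘suc∈p-f0)
            (x∈p⇒∣p-x∣<∣p∣ (f∈p zero))
  where
  f∘suc∈p-f0 : ∀ i → f (suc i) ∈ p - f zero
  f∘suc∈p-f0 i = x∈p∧x≢y⇒x∈p-y (f∈p (suc i)) (0≢1+n ∘ sym ∘ f-injective)

x∉p⇒∣p∣<∣p∪⁅x⁆∣ : ∀ {n} {p : Subset n} {x} → x ∉ p → ∣ p ∣ < ∣ p ∪ ⁅ x ⁆ ∣
x∉p⇒∣p∣<∣p∪⁅x⁆∣ {x = x} x∉p = p⊂q⇒∣p∣<∣q∣ (p⊆p∪q _ , x , x∈p∪q⁺ (inj₂ (x∈⁅x⁆ x)) , x∉p)

module _ {n : ℕ} (G : Graph n) where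

  independent-∪⁅⁆ : ∀ {S v} → Independent G S → (∀ u → u ∈ S → adj G v u ≡ false) →
    Independent G (S ∪ ⁅ v ⁆)
  independent-∪⁅⁆ {S} {v} S-independent v-isolated i j i∈ j∈
    with x∈p∪q⁻ S ⁅ v ⁆ i∈ | x∈p∪q⁻ S ⁅ v ⁆ j∈
  ... | inj₁ i∈S | inj₁ j∈S = S-independent i j i∈S j∈S
  ... | inj₁ i∈S | inj₂ j∈v rewrite x∈⁅y⁆⇒x≡y v j∈v = trans (Graph.sym G i v) (v-isolated i i∈S)
  ... | inj₂ i∈v | inj₁ j∈S rewrite x∈⁅y⁆⇒x≡y v i∈v = v-isolated j j∈S
  ... | inj₂ i∈v | inj₂ j∈v rewrite x∈⁅y⁆⇒x≡y v i∈v | x∈⁅y⁆⇒x≡y v j∈v = loopless G v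

  maxIndependent⇒dominating : ∀ {S} → MaxIndependent G S →
    ∀ v → v ∉ S → ∃ λ u → u ∈ S × Adj G v u
  maxIndependent⇒dominating {S} (S-independent , S-maximum) v v∉S
    with any? (λ u → u ∈? S ×-dec adj G v u ≟ᵇ true)
  ... | yes neighbour = neighbour
  ... | no no-neighbour =
    contradiction (S-maximum (S ∪ ⁅ v ⁆) (independent-∪⁅⁆ S-independent v-isolated))
                  (<⇒≱ (x∉p⇒∣p∣<∣p∪⁅x⁆∣ v∉S))
    where
    v-isolated : ∀ u → u ∈ S → adj G v u ≡ false
    v-isolated u u∈S = ¬-not (λ v~u → no-neighbour (u , u∈S , v~u))

  maxIndependent-reaches : ∀ {S} → MaxIndependent G S →
    ∀ v → ∃ λ u → u ∈ S × Connected G v u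
  maxIndependent-reaches {S} S-max v with v ∈? S
  ... | yes v∈S = v , v∈S , ε
  ... | no v∉S with u , u∈S , v~u ← maxIndependent⇒dominating S-max v v∉S = u , u∈S , v~u ◅ ε

  W⇒disjointMaxIndependent : ∀ {p} → W p G →
    Σ (Fin p → Subset n) λ S → PairwiseDisjoint S × (∀ i → MaxIndependent G (S i))
  W⇒disjointMaxIndependent (_ , extend)
    with S , S-disjoint , S-max , _ ←
      extend (λ _ → ⊥) (λ _ _ _ _ x∈⊥ _ → ∉⊥ x∈⊥) (λ _ _ _ x∈⊥ _ → contradiction x∈⊥ ∉⊥)
    = S , S-disjoint , S-max

module DisjointMaxIndependent {n p} (G : Graph n) {S : Fin p → Subset n}
  (S-disjoint : PairwiseDisjoint S) (S-max : ∀ i → MaxIndependent G (S i)) where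

  nearest : Fin p → Fin n → Fin n
  nearest i v = proj₁ (maxIndependent-reaches G (S-max i) v)

  nearest-∈ : ∀ i v → nearest i v ∈ S i
  nearest-∈ i v = proj₁ (proj₂ (maxIndependent-reaches G (S-max i) v))

  nearest-connected : ∀ i v → Connected G v (nearest i v)
  nearest-connected i v = proj₂ (proj₂ (maxIndependent-reaches G (S-max i) v))

  nearest-injectiveˡ : ∀ {i j} v w → nearest i v ≡ nearest j w → i ≡ j
  nearest-injectiveˡ {i} {j} v w eq with i ≟ j
  ... | yes i≡j = i≡j
  ... | no i≢j = contradiction (subst (_∈ S j) (sym eq) (nearest-∈ j w))
                               (S-disjoint i j i≢j _ (nearest-∈ i v))

  p≤∣component∣ : ∀ {v C} → IsComponentOf G v C → p ≤ ∣ C ∣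
  p≤∣component∣ {v} {C} C-component =
    injective-into⇒≤∣p∣ C (nearest-injectiveˡ v v)
      (λ i → Equivalence.from (C-component _) (nearest-connected i v))

  p*k≤n : ∀ {k} → HasComponentCount G k → p * k ≤ n
  p*k≤n {k} (label , label-surjective , same-label) =
    injective⇒≤ {f = pick ∘ remQuot k} (Injection.injective (↔⇒↣ *↔×) ∘ pick-injective)
    where
    root : Fin k → Fin n
    root c = proj₁ (label-surjective c)

    pick : Fin p × Fin k → Fin n
    pick (i , c) = nearest i (root c)

    label-pick : ∀ i c → label (pick (i , c)) ≡ c
    label-pick i c = trans (sym (Equivalence.from (same-label _ _) (nearest-connected i (root c))))
                           (proj₂ (label-surjective c))

    pick-injective : Injective _≡_ _≡_ pick
    pick-injective {i , c} {j , d} eq with refl ← nearest-injectiveˡ (root c) (root d) eq =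
      cong (i ,_) (trans (sym (label-pick i c)) (trans (cong label eq) (label-pick i d)))

lemma2p5 : ∀ (p : ℕ) → .{{_ : NonZero p}} → ∀ {n : ℕ} (G : Graph n) → W p G →
    (∀ (v : Fin n) (C : Subset n) → IsComponentOf G v C → p ≤ ∣ C ∣)
    × (∀ (k : ℕ) → HasComponentCount G k → p * k ≤ nV G)
lemma2p5 p G w with S , S-disjoint , S-max ← W⇒disjointMaxIndependent G w =
  (λ _ _ → p≤∣component∣) , (λ _ → p*k≤n)
  where open DisjointMaxIndependent G S-disjoint S-max
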